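{- Suppose $P$ is a poset. Then $P$ is a $2$-chain if and only if its comparability graph is a $2$-clique.
   Context: All posets and graphs are finite; partial orders are written $\preceq$. A poset $(P,\preceq)$ is a $2$-chain if (1) there is a unique way to write $P$ as the union of two chains, and (2) $\preceq$ is maximal subject to (1), i.e. for every proper refinement $\preceq^+$ of $\preceq$ there is more than one way to write $P$ as the union of two $\preceq^+$-chains. A graph $G=(V,E)$ is a $2$-clique if $V$ can be uniquely expressed as the union of two cliques and adding any edge to $E$ breaks this uniqueness (equivalently, the complement of $G$ is a tree). The comparability graph of $P$ has vertex set $P$, with an edge between $p$ and $q$ if and only if $p\prec q$ or $q\prec p$. -}

module Defs where

open import Level using (0ℓ)
open import Data.Nat using (ℕ)
open import Data.Fin using (Fin)
open import Data.Bool using (Bool; not)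
open import Data.Product using (Σ; ∃; ∃-syntax; _×_; _,_)
open import Data.Sum using (_⊎_)
open import Relation.Nullary using (¬_)
open import Relation.Binary using (Rel; IsDecPartialOrder)
open import Relation.Binary.PropositionalEquality using (_≡_; _≢_)

record FinPoset (n : ℕ) : Set₁ where
  field
    _≼_ : Rel (Fin n) 0ℓ
    isDecPartialOrder : IsDecPartialOrder _≡_ _≼_

record Graph (n : ℕ) : Set₁ where
  field
    Adj : Rel (Fin n) 0ℓ
    Adj-sym : ∀ {x y} → Adj x y → Adj y x
    Adj-irrefl : ∀ {x} → ¬ Adj x x

-- A way to write the vertex set as the union of two parts is encoded by a
-- colouring c : Fin n → Bool (parts c⁻¹ true and c⁻¹ false).
SameDecomposition : ∀ {n} → (Fin n → Bool) → (Fin n → Bool) → Set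
SameDecomposition c d = (∀ x → c x ≡ d x) ⊎ (∀ x → c x ≡ not (d x))

UniqueDecomposition : ∀ {n} → ((Fin n → Bool) → Set) → Set
UniqueDecomposition Valid =
  Σ _ λ c → Valid c × (∀ d → Valid d → SameDecomposition c d)

SeveralDecompositions : ∀ {n} → ((Fin n → Bool) → Set) → Set
SeveralDecompositions Valid =
  Σ _ λ c → Σ _ λ d → Valid c × Valid d × ¬ SameDecomposition c d

TwoChainCover : ∀ {n} → Rel (Fin n) 0ℓ → (Fin n → Bool) → Set
TwoChainCover _≼_ c = ∀ x y → c x ≡ c y → (x ≼ y) ⊎ (y ≼ x)

ProperRefinement : ∀ {n} → FinPoset n → FinPoset n → Set
ProperRefinement P Q =
  (∀ x y → x ≼P y → x ≼Q y) × (∃[ x ] ∃[ y ] (x ≼Q y × ¬ (x ≼P y)))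
  where
    open FinPoset P renaming (_≼_ to _≼P_)
    open FinPoset Q renaming (_≼_ to _≼Q_)

IsTwoChain : ∀ {n} → FinPoset n → Set₁
IsTwoChain {n} P =
  UniqueDecomposition (TwoChainCover (FinPoset._≼_ P))
  × ((Q : FinPoset n) → ProperRefinement P Q →
       SeveralDecompositions (TwoChainCover (FinPoset._≼_ Q)))

TwoCliqueCover : ∀ {n} → Rel (Fin n) 0ℓ → (Fin n → Bool) → Set
TwoCliqueCover Adj c = ∀ x y → x ≢ y → c x ≡ c y → Adj x y

addEdgeRel : ∀ {n} → Rel (Fin n) 0ℓ → Fin n → Fin n → Rel (Fin n) 0ℓ
addEdgeRel Adj u v x y = Adj x y ⊎ ((x ≡ u × y ≡ v) ⊎ (x ≡ v × y ≡ u))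

IsTwoClique : ∀ {n} → Graph n → Set
IsTwoClique G =
  UniqueDecomposition (TwoCliqueCover Adj)
  × (∀ u v → u ≢ v → ¬ Adj u v →
       SeveralDecompositions (TwoCliqueCover (addEdgeRel Adj u v)))
  where open Graph G

comparabilityGraph : ∀ {n} → FinPoset n → Graph n
comparabilityGraph P = record
  { Adj = λ p q → (p ≼ q × p ≢ q) ⊎ (q ≼ p × q ≢ p)
  ; Adj-sym = λ { (Data.Sum.inj₁ a) → Data.Sum.inj₂ a ; (Data.Sum.inj₂ a) → Data.Sum.inj₁ a }
  ; Adj-irrefl = λ { (Data.Sum.inj₁ (_ , ne)) → ne _≡_.refl ; (Data.Sum.inj₂ (_ , ne)) → ne _≡_.refl }
  }
  where open FinPoset P

-- Chain covers of P are exactly clique covers of its comparability graph, i.e. proper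
-- 2-colourings of the incomparability graph H.  A proper refinement of P adds x ≼ y for
-- some x ∥ y, and decompositions of G + xy are chain covers of that refinement; this
-- gives "2-clique ⇒ 2-chain".  Conversely, every edge uv of H must be a bridge: flipping
-- the colours on v's side gives a second decomposition of G + uv.  That v's side is
-- well defined rests on P containing no induced 2 + 2, for such a configuration lies
-- under a critical pair whose addition to P would keep the decomposition unique.
module Submission where

open import Level using (0ℓ)
open import Data.Nat using (ℕ)
open import Data.Bool using (Bool; not)
import Data.Bool as Bool
open import Data.Bool.Properties using (not-involutive; not-injective; not-¬; ¬-not)
open import Data.Empty using (⊥; ⊥-elim)
open import Data.Fin using (Fin; _≟_)
open import Data.Fin.Properties using (any?)
open import Data.List using (List; []; _∷_; allFin)
open import Data.List.Membership.Propositional using (_∈_)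
open import Data.List.Membership.Propositional.Properties using (∈-allFin)
open import Data.List.Relation.Unary.Any using (here; there)
open import Data.Product using (_×_; ∃-syntax; ∃₂; _,_; proj₁; proj₂; swap)
open import Data.Sum using (_⊎_; inj₁; inj₂)
import Data.Sum as Sum
open import Function using (flip; _∘_; id)
open import Relation.Nullary using (¬_; yes; no)
open import Relation.Nullary.Decidable using (_×-dec_; _⊎-dec_; ¬?)
open import Relation.Unary using (Pred)
open import Relation.Binary using (Rel; Decidable; IsDecPartialOrder; IsStrictPartialOrder)
import Relation.Binary.Construct.Flip.EqAndOrd as Flip
open import Relation.Binary.Construct.NonStrictToStrict using (<-isStrictPartialOrder)
open import Relation.Binary.PropositionalEquality
  using (_≡_; _≢_; refl; sym; trans; cong; ≢-sym; isEquivalence)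

open import Defs

module _ {n : ℕ} where

  SameDecomposition-sym : {c d : Fin n → Bool} → SameDecomposition c d → SameDecomposition d c
  SameDecomposition-sym (inj₁ c≗d) = inj₁ λ x → sym (c≗d x)
  SameDecomposition-sym {d = d} (inj₂ c≗¬d) = inj₂ λ x →
    sym (trans (cong not (c≗¬d x)) (not-involutive (d x)))

  SameDecomposition-trans : {c d e : Fin n → Bool} →
                            SameDecomposition c d → SameDecomposition d e → SameDecomposition c e
  SameDecomposition-trans (inj₁ c≗d) (inj₁ d≗e) = inj₁ λ x → trans (c≗d x) (d≗e x)
  SameDecomposition-trans (inj₁ c≗d) (inj₂ d≗¬e) = inj₂ λ x → trans (c≗d x) (d≗¬e x)
  SameDecomposition-trans (inj₂ c≗¬d) (inj₁ d≗e) = inj₂ λ x → trans (c≗¬d x) (cong not (d≗e x))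
  SameDecomposition-trans {e = e} (inj₂ c≗¬d) (inj₂ d≗¬e) = inj₁ λ x →
    trans (c≗¬d x) (trans (cong not (d≗¬e x)) (not-involutive (e x)))

  UniqueDecomposition-resp : {V W : (Fin n → Bool) → Set} →
                             (∀ c → V c → W c) → (∀ c → W c → V c) →
                             UniqueDecomposition V → UniqueDecomposition W
  UniqueDecomposition-resp V⇒W W⇒V (c , Vc , unique) =
    c , V⇒W c Vc , λ d Wd → unique d (W⇒V d Wd)

  SeveralDecompositions-map : {V W : (Fin n → Bool) → Set} →
                              (∀ c → V c → W c) → SeveralDecompositions V → SeveralDecompositions W
  SeveralDecompositions-map V⇒W (c , d , Vc , Vd , c≁d) = c , d , V⇒W c Vc , V⇒W d Vd , c≁d

module _ {n ℓ p} {_<_ : Rel (Fin n) ℓ} (isStrictPartialOrder : IsStrictPartialOrder _≡_ _<_)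
         (_<?_ : Decidable _<_) {S : Pred (Fin n) p} (S? : Relation.Unary.Decidable S) where

  open IsStrictPartialOrder isStrictPartialOrder using (irrefl) renaming (trans to <-trans)

  private
    maximalAmong : (xs : List (Fin n)) → ∀ {s} → S s →
                   ∃[ m ] S m × (∀ {x} → x ∈ xs → S x → ¬ m < x)
    maximalAmong [] Ss = _ , Ss , λ ()
    maximalAmong (y ∷ xs) Ss with maximalAmong xs Ss
    ... | m , Sm , m-maximal with S? y ×-dec m <? y
    ...   | yes (Sy , m<y) = y , Sy , λ
      { (here refl) _ → irrefl refl
      ; (there x∈xs) Sx y<x → m-maximal x∈xs Sx (<-trans m<y y<x) }
    ...   | no ¬[Sy×m<y] = m , Sm , λ
      { (here refl) Sy m<y → ¬[Sy×m<y] (Sy , m<y)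
      ; (there x∈xs) Sx → m-maximal x∈xs Sx }

  ∃-maximal : ∀ {s} → S s → ∃[ m ] S m × (∀ {x} → S x → ¬ m < x)
  ∃-maximal Ss with maximalAmong (allFin n) Ss
  ... | m , Sm , m-maximal = m , Sm , λ Sx → m-maximal (∈-allFin _) Sx

module _ {n : ℕ} (P : FinPoset n) where

  open FinPoset P
  open IsDecPartialOrder isDecPartialOrder
    using (isPartialOrder; _≤?_)
    renaming (refl to ≼-refl; reflexive to ≼-reflexive; trans to ≼-trans; antisym to ≼-antisym)
  open Graph (comparabilityGraph P) using (Adj)

  infix 4 _∥_ _≺_

  _≺_ : Rel (Fin n) 0ℓ
  x ≺ y = x ≼ y × x ≢ y

  _∥_ : Rel (Fin n) 0ℓ
  x ∥ y = ¬ x ≼ y × ¬ y ≼ x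

  ∥-sym : ∀ {x y} → x ∥ y → y ∥ x
  ∥-sym (x⋠y , y⋠x) = y⋠x , x⋠y

  ∥⇒≢ : ∀ {x y} → x ∥ y → x ≢ y
  ∥⇒≢ (x⋠y , _) x≡y = x⋠y (≼-reflexive x≡y)

  ≺-isStrictPartialOrder : IsStrictPartialOrder _≡_ _≺_
  ≺-isStrictPartialOrder = <-isStrictPartialOrder _≡_ _≼_ isPartialOrder

  ≺? : Decidable _≺_
  ≺? x y = x ≤? y ×-dec ¬? (x ≟ y)

  _∥?_ : Decidable _∥_
  x ∥? y = ¬? (x ≤? y) ×-dec ¬? (y ≤? x)

  compare : ∀ x y → x ≼ y ⊎ y ≼ x ⊎ x ∥ y
  compare x y with x ≤? y | y ≤? x
  ... | yes x≼y | _ = inj₁ x≼y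
  ... | no _ | yes y≼x = inj₂ (inj₁ y≼x)
  ... | no x⋠y | no y⋠x = inj₂ (inj₂ (x⋠y , y⋠x))

  chainCover⇒cliqueCover : ∀ c → TwoChainCover _≼_ c → TwoCliqueCover Adj c
  chainCover⇒cliqueCover c cover x y x≢y cx≡cy =
    Sum.map (_, x≢y) (_, ≢-sym x≢y) (cover x y cx≡cy)

  cliqueCover⇒chainCover : ∀ c → TwoCliqueCover Adj c → TwoChainCover _≼_ c
  cliqueCover⇒chainCover c cover x y cx≡cy with x ≟ y
  ... | yes refl = inj₁ ≼-refl
  ... | no x≢y = Sum.map proj₁ proj₁ (cover x y x≢y cx≡cy)

  ¬Adj⇒∥ : ∀ {x y} → x ≢ y → ¬ Adj x y → x ∥ y
  ¬Adj⇒∥ x≢y ¬adj = (λ x≼y → ¬adj (inj₁ (x≼y , x≢y))) , (λ y≼x → ¬adj (inj₂ (y≼x , ≢-sym x≢y)))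

  chainCover-∥ : ∀ {c x y} → TwoChainCover _≼_ c → x ∥ y → c x ≢ c y
  chainCover-∥ {x = x} {y} cover (x⋠y , y⋠x) cx≡cy = Sum.[ x⋠y , y⋠x ] (cover x y cx≡cy)

  addEdge-cover⇒refinement-cover : (Q : FinPoset n) → (∀ x y → x ≼ y → FinPoset._≼_ Q x y) →
    ∀ {x y} → FinPoset._≼_ Q x y → ∀ c → TwoCliqueCover (addEdgeRel Adj x y) c →
    TwoChainCover (FinPoset._≼_ Q) c
  addEdge-cover⇒refinement-cover Q ≼⇒≼Q x≼Qy c cover a b ca≡cb with a ≟ b
  ... | yes refl = inj₁ (IsDecPartialOrder.refl (FinPoset.isDecPartialOrder Q))
  ... | no a≢b with cover a b a≢b ca≡cb
  ...   | inj₁ (inj₁ (a≼b , _)) = inj₁ (≼⇒≼Q a b a≼b)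
  ...   | inj₁ (inj₂ (b≼a , _)) = inj₂ (≼⇒≼Q b a b≼a)
  ...   | inj₂ (inj₁ (refl , refl)) = inj₁ x≼Qy
  ...   | inj₂ (inj₂ (refl , refl)) = inj₂ x≼Qy

  record CriticalPair (a b : Fin n) : Set where
    field
      incomparable : a ∥ b
      below : ∀ {x} → x ≺ a → x ≼ b
      above : ∀ {y} → b ≺ y → a ≼ y

  module AddCriticalPair {a b : Fin n} (critical : CriticalPair a b) where

    open CriticalPair critical

    infix 4 _≼⁺_

    _≼⁺_ : Rel (Fin n) 0ℓ
    x ≼⁺ y = x ≼ y ⊎ (x ≡ a × y ≡ b)

    private
      ≼⁺-trans : ∀ {x y z} → x ≼⁺ y → y ≼⁺ z → x ≼⁺ z
      ≼⁺-trans (inj₁ x≼y) (inj₁ y≼z) = inj₁ (≼-trans x≼y y≼z)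
      ≼⁺-trans {x} (inj₁ x≼a) (inj₂ (refl , refl)) with x ≟ a
      ... | yes x≡a = inj₂ (x≡a , refl)
      ... | no x≢a = inj₁ (below (x≼a , x≢a))
      ≼⁺-trans {z = z} (inj₂ (refl , refl)) (inj₁ b≼z) with b ≟ z
      ... | yes b≡z = inj₂ (refl , sym b≡z)
      ... | no b≢z = inj₁ (above (b≼z , b≢z))
      ≼⁺-trans (inj₂ (refl , refl)) (inj₂ (b≡a , _)) = ⊥-elim (∥⇒≢ incomparable (sym b≡a))

      ≼⁺-antisym : ∀ {x y} → x ≼⁺ y → y ≼⁺ x → x ≡ y
      ≼⁺-antisym (inj₁ x≼y) (inj₁ y≼x) = ≼-antisym x≼y y≼x
      ≼⁺-antisym (inj₁ b≼a) (inj₂ (refl , refl)) = ⊥-elim (proj₂ incomparable b≼a)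
      ≼⁺-antisym (inj₂ (refl , refl)) (inj₁ b≼a) = ⊥-elim (proj₂ incomparable b≼a)
      ≼⁺-antisym (inj₂ (refl , refl)) (inj₂ (b≡a , _)) = ⊥-elim (∥⇒≢ incomparable (sym b≡a))

    poset : FinPoset n
    poset = record
      { _≼_ = _≼⁺_
      ; isDecPartialOrder = record
        { isPartialOrder = record
          { isPreorder = record
            { isEquivalence = isEquivalence
            ; reflexive = λ x≡y → inj₁ (≼-reflexive x≡y)
            ; trans = ≼⁺-trans
            }
          ; antisym = ≼⁺-antisym
          }
        ; _≟_ = _≟_
        ; _≤?_ = λ x y → x ≤? y ⊎-dec (x ≟ a ×-dec y ≟ b)
        }
      }

    proper : ProperRefinement P poset
    proper = (λ _ _ → inj₁) , a , b , inj₂ (refl , refl) , proj₁ incomparable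

    ∥-separated : ∀ {d x y} → TwoChainCover _≼⁺_ d → x ∥ y →
                  ¬ (x ≡ a × y ≡ b) → ¬ (y ≡ a × x ≡ b) → d x ≢ d y
    ∥-separated {x = x} {y} cover (x⋠y , y⋠x) ¬[xy≡ab] ¬[yx≡ab] dx≡dy with cover x y dx≡dy
    ... | inj₁ x≼⁺y = Sum.[ x⋠y , ¬[xy≡ab] ] x≼⁺y
    ... | inj₂ y≼⁺x = Sum.[ y⋠x , ¬[yx≡ab] ] y≼⁺x

    -- Each link of the path survives in the refinement, and a path of odd length
    -- separates its ends.
    path⇒separated : ∀ {a' b'} → b' ∥ a → a' ∥ b' → a' ∥ b → a' ≢ a → b' ≢ b →
                     ∀ {d} → TwoChainCover _≼⁺_ d → d a ≢ d b
    path⇒separated b'∥a a'∥b' a'∥b a'≢a b'≢b {d} cover da≡db = da'≢db (trans (sym da≡da') da≡db)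
      where
      a≢b = ∥⇒≢ incomparable
      db'≢da = ∥-separated cover b'∥a (λ (_ , a≡b) → a≢b a≡b) (λ (_ , b'≡b) → b'≢b b'≡b)
      da'≢db' = ∥-separated cover a'∥b' (λ (a'≡a , _) → a'≢a a'≡a)
                                       (λ (b'≡a , _) → proj₁ b'∥a (≼-reflexive b'≡a))
      da'≢db = ∥-separated cover a'∥b (λ (a'≡a , _) → a'≢a a'≡a) (λ (b≡a , _) → a≢b (sym b≡a))
      da≡da' = trans (¬-not (≢-sym db'≢da)) (sym (¬-not da'≢db'))

    separated⇒cover-restricts : ∀ {d} → TwoChainCover _≼⁺_ d → d a ≢ d b → TwoChainCover _≼_ d
    separated⇒cover-restricts cover da≢db x y dx≡dy with cover x y dx≡dy
    ... | inj₁ (inj₁ x≼y) = inj₁ x≼y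
    ... | inj₂ (inj₁ y≼x) = inj₂ y≼x
    ... | inj₁ (inj₂ (refl , refl)) = ⊥-elim (da≢db dx≡dy)
    ... | inj₂ (inj₂ (refl , refl)) = ⊥-elim (da≢db (sym dx≡dy))

  -- Take b₀ maximal among the y ≽ b incomparable to a, then a₀ minimal among the
  -- x ≼ a incomparable to b₀.
  critical-pair-dominating : ∀ {a b} → a ∥ b →
    ∃₂ λ a₀ b₀ → CriticalPair a₀ b₀ × a₀ ≼ a × b ≼ b₀ × a ∥ b₀
  critical-pair-dominating {a} {b} a∥b
    with ∃-maximal ≺-isStrictPartialOrder ≺? (λ y → b ≤? y ×-dec a ∥? y) (≼-refl , a∥b)
  ... | b₀ , (b≼b₀ , a∥b₀) , b₀-maximal
    with ∃-maximal (Flip.isStrictPartialOrder ≺-isStrictPartialOrder) (flip ≺?)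
                   (λ x → x ≤? a ×-dec x ∥? b₀) (≼-refl , a∥b₀)
  ... | a₀ , (a₀≼a , a₀∥b₀) , a₀-minimal = a₀ , b₀ , critical , a₀≼a , b≼b₀ , a∥b₀
    where
    critical : CriticalPair a₀ b₀
    critical .CriticalPair.incomparable = a₀∥b₀
    critical .CriticalPair.below {x} x≺a₀@(x≼a₀ , _) with compare x b₀
    ... | inj₁ x≼b₀ = x≼b₀
    ... | inj₂ (inj₁ b₀≼x) = ⊥-elim (proj₂ a₀∥b₀ (≼-trans b₀≼x x≼a₀))
    ... | inj₂ (inj₂ x∥b₀) = ⊥-elim (a₀-minimal (≼-trans x≼a₀ a₀≼a , x∥b₀) x≺a₀)
    critical .CriticalPair.above {y} b₀≺y@(b₀≼y , _) with compare a y
    ... | inj₁ a≼y = ≼-trans a₀≼a a≼y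
    ... | inj₂ (inj₁ y≼a) = ⊥-elim (proj₂ a∥b₀ (≼-trans b₀≼y y≼a))
    ... | inj₂ (inj₂ a∥y) = ⊥-elim (b₀-maximal (≼-trans b≼b₀ b₀≼y , a∥y) b₀≺y)

  module TwoChain (twoChain : IsTwoChain P) where

    private
      c : Fin n → Bool
      c = proj₁ (proj₁ twoChain)

      c-cover : TwoChainCover _≼_ c
      c-cover = proj₁ (proj₂ (proj₁ twoChain))

      c-unique : ∀ d → TwoChainCover _≼_ d → SameDecomposition c d
      c-unique = proj₂ (proj₂ (proj₁ twoChain))

    restricting-covers-not-several : ∀ {V} → (∀ d → V d → TwoChainCover _≼_ d) →
                                     ¬ SeveralDecompositions V
    restricting-covers-not-several restrict (d , e , Vd , Ve , d≁e) =
      d≁e (SameDecomposition-trans (SameDecomposition-sym (c-unique d (restrict d Vd)))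
                                   (c-unique e (restrict e Ve)))

    critical-pair-path : ∀ {a b a' b'} → CriticalPair a b →
      b' ∥ a → a' ∥ b' → a' ∥ b → a' ≢ a → b' ≢ b → ⊥
    critical-pair-path critical b'∥a a'∥b' a'∥b a'≢a b'≢b =
      restricting-covers-not-several restrict (proj₂ twoChain poset proper)
      where
      open AddCriticalPair critical
      restrict : ∀ d → TwoChainCover _≼⁺_ d → TwoChainCover _≼_ d
      restrict d cover =
        separated⇒cover-restricts cover (path⇒separated b'∥a a'∥b' a'∥b a'≢a b'≢b cover)

    -- An induced 2 + 2; the incomparabilities a ∥ b and a' ∥ b' follow from the other two.
    no-2+2 : ∀ {a a' b b'} → a ≺ a' → b ≺ b' → a ∥ b' → a' ∥ b → ⊥
    no-2+2 {a} {a'} {b} {b'} (a≼a' , a≢a') (b≼b' , b≢b') a∥b' a'∥b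
      with critical-pair-dominating a∥b'
    ... | a₀ , b₀ , critical , a₀≼a , b'≼b₀ , a∥b₀ =
      critical-pair-path critical b∥a₀ a'∥b a'∥b₀ a'≢a₀ b≢b₀
      where
      b∥a₀ : b ∥ a₀
      b∥a₀ = (λ b≼a₀ → proj₂ a'∥b (≼-trans b≼a₀ (≼-trans a₀≼a a≼a')))
           , (λ a₀≼b → proj₁ (CriticalPair.incomparable critical)
                                (≼-trans a₀≼b (≼-trans b≼b' b'≼b₀)))
      a'∥b₀ : a' ∥ b₀
      a'∥b₀ = (λ a'≼b₀ → proj₁ a∥b₀ (≼-trans a≼a' a'≼b₀))
            , (λ b₀≼a' → proj₂ a'∥b (≼-trans b≼b' (≼-trans b'≼b₀ b₀≼a')))
      a'≢a₀ : a' ≢ a₀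
      a'≢a₀ refl = a≢a' (≼-antisym a≼a' a₀≼a)
      b≢b₀ : b ≢ b₀
      b≢b₀ refl = b≢b' (≼-antisym b≼b' b'≼b₀)

    module Recolouring {u v} (u∥v : u ∥ v) where

      Below Above : Pred (Fin n) 0ℓ
      Below w = w ≺ u ⊎ w ≺ v
      Above w = u ≺ w ⊎ v ≺ w

      Attached : Pred (Fin n) 0ℓ → Set
      Attached Side = ∃[ z ] Side z × z ∥ v

      -- v's side of the bridge uv of the incomparability graph.
      OnVSide : Pred (Fin n) 0ℓ
      OnVSide w = w ≡ v ⊎ (Below w × Attached Below) ⊎ (Above w × Attached Above)

      OnVSide? : Relation.Unary.Decidable OnVSide
      OnVSide? w = w ≟ v ⊎-dec (Below? w ×-dec any? (λ z → Below? z ×-dec z ∥? v))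
                         ⊎-dec (Above? w ×-dec any? (λ z → Above? z ×-dec z ∥? v))
        where
        Below? Above? : Relation.Unary.Decidable _
        Below? w = ≺? w u ⊎-dec ≺? w v
        Above? w = ≺? u w ⊎-dec ≺? v w

      recoloured : Fin n → Bool
      recoloured w with OnVSide? w
      ... | yes _ = not (c w)
      ... | no _ = c w

      Below⊎Above : ∀ {w} → w ≢ u → w ≢ v → Below w ⊎ Above w
      Below⊎Above {w} w≢u w≢v with c w Bool.≟ c u
      ... | yes cw≡cu = Sum.map (λ w≼u → inj₁ (w≼u , w≢u)) (λ u≼w → inj₁ (u≼w , ≢-sym w≢u))
                                (c-cover w u cw≡cu)
      ... | no cw≢cu = Sum.map (λ w≼v → inj₂ (w≼v , w≢v)) (λ v≼w → inj₂ (v≼w , ≢-sym w≢v))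
                               (c-cover w v cw≡cv)
        where
        cw≡cv : c w ≡ c v
        cw≡cv = trans (¬-not cw≢cu) (sym (¬-not (≢-sym (chainCover-∥ c-cover u∥v))))

      Below-Above-comparable : ∀ {x y} → Below x → Above y → ¬ x ∥ y
      Below-Above-comparable (inj₁ (x≼u , _)) (inj₁ (u≼y , _)) (x⋠y , _) = x⋠y (≼-trans x≼u u≼y)
      Below-Above-comparable (inj₂ (x≼v , _)) (inj₂ (v≼y , _)) (x⋠y , _) = x⋠y (≼-trans x≼v v≼y)
      Below-Above-comparable (inj₁ x≺u) (inj₂ v≺y) x∥y = no-2+2 x≺u v≺y x∥y u∥v
      Below-Above-comparable (inj₂ x≺v) (inj₁ u≺y) x∥y = no-2+2 x≺v u≺y x∥y (∥-sym u∥v)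

      Below-∥u-∥v : ∀ {x z} → Below x → Below z → x ∥ u → z ∥ v → ⊥
      Below-∥u-∥v (inj₁ (x≼u , _)) _ (x⋠u , _) _ = x⋠u x≼u
      Below-∥u-∥v _ (inj₂ (z≼v , _)) _ (z⋠v , _) = z⋠v z≼v
      Below-∥u-∥v (inj₂ x≺v) (inj₁ z≺u) x∥u z∥v = no-2+2 z≺u x≺v z∥v (∥-sym x∥u)

      Above-∥u-∥v : ∀ {x z} → Above x → Above z → x ∥ u → z ∥ v → ⊥
      Above-∥u-∥v (inj₁ (u≼x , _)) _ (_ , u⋠x) _ = u⋠x u≼x
      Above-∥u-∥v _ (inj₂ (v≼z , _)) _ (_ , v⋠z) = v⋠z v≼z
      Above-∥u-∥v (inj₂ v≺x) (inj₁ u≺z) x∥u z∥v = no-2+2 u≺z v≺x (∥-sym x∥u) z∥v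

      u∉OnVSide : ¬ OnVSide u
      u∉OnVSide (inj₁ u≡v) = ∥⇒≢ u∥v u≡v
      u∉OnVSide (inj₂ (inj₁ (inj₁ (_ , u≢u) , _))) = u≢u refl
      u∉OnVSide (inj₂ (inj₁ (inj₂ (u≼v , _) , _))) = proj₁ u∥v u≼v
      u∉OnVSide (inj₂ (inj₂ (inj₁ (_ , u≢u) , _))) = u≢u refl
      u∉OnVSide (inj₂ (inj₂ (inj₂ (v≼u , _) , _))) = proj₂ u∥v v≼u

      OnVSide-∥u⇒≡v : ∀ {x} → OnVSide x → x ∥ u → x ≡ v
      OnVSide-∥u⇒≡v (inj₁ x≡v) _ = x≡v
      OnVSide-∥u⇒≡v (inj₂ (inj₁ (x-below , _ , z-below , z∥v))) x∥u =
        ⊥-elim (Below-∥u-∥v x-below z-below x∥u z∥v)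
      OnVSide-∥u⇒≡v (inj₂ (inj₂ (x-above , _ , z-above , z∥v))) x∥u =
        ⊥-elim (Above-∥u-∥v x-above z-above x∥u z∥v)

      Below-attached : ∀ {x y} → x ∥ y → OnVSide x → Below y → Attached Below
      Below-attached x∥y (inj₁ refl) y-below = _ , y-below , ∥-sym x∥y
      Below-attached _ (inj₂ (inj₁ (_ , attached))) _ = attached
      Below-attached x∥y (inj₂ (inj₂ (x-above , _))) y-below =
        ⊥-elim (Below-Above-comparable y-below x-above (∥-sym x∥y))

      Above-attached : ∀ {x y} → x ∥ y → OnVSide x → Above y → Attached Above
      Above-attached x∥y (inj₁ refl) y-above = _ , y-above , ∥-sym x∥y
      Above-attached x∥y (inj₂ (inj₁ (x-below , _))) y-above =
        ⊥-elim (Below-Above-comparable x-below y-above x∥y)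
      Above-attached _ (inj₂ (inj₂ (_ , attached))) _ = attached

      OnVSide-∥-closed : ∀ {x y} → x ∥ y → OnVSide x → OnVSide y ⊎ (x ≡ v × y ≡ u)
      OnVSide-∥-closed {y = y} x∥y x∈ with y ≟ v | y ≟ u
      ... | yes y≡v | _ = inj₁ (inj₁ y≡v)
      ... | no _ | yes refl = inj₂ (OnVSide-∥u⇒≡v x∈ x∥y , refl)
      ... | no y≢v | no y≢u = inj₁ (inj₂ (Sum.map
        (λ y-below → y-below , Below-attached x∥y x∈ y-below)
        (λ y-above → y-above , Above-attached x∥y x∈ y-above)
        (Below⊎Above y≢u y≢v)))

      recoloured-cover : TwoCliqueCover (addEdgeRel Adj u v) recoloured
      recoloured-cover x y x≢y dx≡dy with compare x y
      ... | inj₁ x≼y = inj₁ (inj₁ (x≼y , x≢y))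
      ... | inj₂ (inj₁ y≼x) = inj₁ (inj₂ (y≼x , ≢-sym x≢y))
      ... | inj₂ (inj₂ x∥y) with OnVSide? x | OnVSide? y
      ...   | yes _ | yes _ = ⊥-elim (chainCover-∥ c-cover x∥y (not-injective dx≡dy))
      ...   | no _ | no _ = ⊥-elim (chainCover-∥ c-cover x∥y dx≡dy)
      ...   | yes x∈ | no y∉ =
        inj₂ (inj₂ (Sum.[ ⊥-elim ∘ y∉ , id ] (OnVSide-∥-closed x∥y x∈)))
      ...   | no x∉ | yes y∈ =
        inj₂ (inj₁ (Sum.[ ⊥-elim ∘ x∉ , swap ] (OnVSide-∥-closed (∥-sym x∥y) y∈)))

      recoloured-differs : ¬ SameDecomposition c recoloured
      recoloured-differs (inj₁ c≗d) with OnVSide? v | c≗d v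
      ... | yes _ | cv≡¬cv = not-¬ refl cv≡¬cv
      ... | no v∉ | _ = v∉ (inj₁ refl)
      recoloured-differs (inj₂ c≗¬d) with OnVSide? u | c≗¬d u
      ... | yes u∈ | _ = u∉OnVSide u∈
      ... | no _ | cu≡¬cu = not-¬ refl cu≡¬cu

    addEdge-several : ∀ {u v} → u ∥ v → SeveralDecompositions (TwoCliqueCover (addEdgeRel Adj u v))
    addEdge-several u∥v =
      c , recoloured , (λ x y x≢y cx≡cy → inj₁ (chainCover⇒cliqueCover c c-cover x y x≢y cx≡cy)) ,
      recoloured-cover , recoloured-differs
      where open Recolouring u∥v

  twoChain⇒twoClique : IsTwoChain P → IsTwoClique (comparabilityGraph P)
  twoChain⇒twoClique twoChain =
    UniqueDecomposition-resp chainCover⇒cliqueCover cliqueCover⇒chainCover (proj₁ twoChain) ,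
    λ u v u≢v ¬adj → TwoChain.addEdge-several twoChain (¬Adj⇒∥ u≢v ¬adj)

  twoClique⇒twoChain : IsTwoClique (comparabilityGraph P) → IsTwoChain P
  twoClique⇒twoChain (unique , addEdge-several) =
    UniqueDecomposition-resp cliqueCover⇒chainCover chainCover⇒cliqueCover unique , refinement-several
    where
    refinement-several : (Q : FinPoset n) → ProperRefinement P Q →
                         SeveralDecompositions (TwoChainCover (FinPoset._≼_ Q))
    refinement-several Q (≼⇒≼Q , x , y , x≼Qy , x⋠y) =
      SeveralDecompositions-map (addEdge-cover⇒refinement-cover Q ≼⇒≼Q x≼Qy)
                                (addEdge-several x y x≢y ¬adj)
      where
      x≢y : x ≢ y
      x≢y refl = x⋠y ≼-refl
      ¬adj : ¬ Adj x y
      ¬adj (inj₁ (x≼y , _)) = x⋠y x≼y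
      ¬adj (inj₂ (y≼x , _)) =
        x≢y (IsDecPartialOrder.antisym (FinPoset.isDecPartialOrder Q) x≼Qy (≼⇒≼Q y x y≼x))

proposition6p1 : ∀ {n : ℕ} (P : FinPoset n) → (IsTwoChain P → IsTwoClique (comparabilityGraph P)) × (IsTwoClique (comparabilityGraph P) → IsTwoChain P)
proposition6p1 P = twoChain⇒twoClique P , twoClique⇒twoChain P
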